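{- Let $G$ be a $2$-edge-connected cubic graph with a $2$-factor consisting of two chordless circuits $C_1$ and $C_2$. Then $G$ has a $5$-CDC $\mathcal S$ with $C_1 \in \mathcal S$.
   Context: A circuit is a $2$-regular connected graph; a cycle is a graph in which every vertex has even degree. A cycle double cover (CDC) of $G$ is a set of cycles of $G$ such that every edge lies in the edge sets of exactly two of them; a $5$-CDC is a CDC consisting of $5$ cycles. -}

module Defs where

open import Data.Nat using (ℕ; zero; suc; _<_; _+_)
open import Data.Bool using (Bool; true; false; _∨_)
open import Data.Fin using (Fin; _≟_)
open import Data.Fin.Subset using (Subset; ⊤; _∩_; _∪_; _-_; ∣_∣; _∈_; _∉_; Empty; inside)
open import Data.Vec using (tabulate; lookup)
open import Data.Product using (Σ; _×_; ∃)
open import Data.Sum using (_⊎_)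
open import Relation.Nullary using (¬_; does)
open import Relation.Binary.PropositionalEquality using (_≡_; _≢_)

-- Loops are excluded; in a
-- 2-edge-connected cubic graph loops cannot occur anyway.
-- n is even
Even : ℕ → Set
Even k = Σ ℕ (λ j → k ≡ j + j)

record Graph : Set where
  field
    n m      : ℕ
    src tgt  : Fin m → Fin n
    loopless : ∀ e → src e ≢ tgt e

module _ (G : Graph) where
  open Graph G

  ESet : Set
  ESet = Subset m

  incident : Fin n → ESet
  incident v = tabulate (λ e → does (src e ≟ v) ∨ does (tgt e ≟ v))

  deg : ESet → Fin n → ℕ
  deg S v = ∣ S ∩ incident v ∣

  OnV : ESet → Fin n → Set
  OnV S v = 0 < deg S v

  Cubic : Set
  Cubic = ∀ v → deg ⊤ v ≡ 3

  data Reach (S : ESet) : Fin n → Fin n → Set where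
    here : ∀ {u} → Reach S u u
    step : ∀ {u w} e → e ∈ S → src e ≡ u → tgt e ≡ w → ∀ {v} → Reach S w v → Reach S u v
    stepᵣ : ∀ {u w} e → e ∈ S → tgt e ≡ u → src e ≡ w → ∀ {v} → Reach S w v → Reach S u v

  Connected : Set
  Connected = ∀ u v → Reach ⊤ u v

  TwoEdgeConnected : Set
  TwoEdgeConnected = Connected × (∀ e u v → Reach (⊤ - e) u v)

  IsCycle : ESet → Set
  IsCycle S = ∀ v → Even (deg S v)

  IsCircuit : ESet → Set
  IsCircuit C = (¬ Empty C)
              × (∀ v → OnV C v → deg C v ≡ 2)
              × (∀ u v → OnV C u → OnV C v → Reach C u v)

  Chordless : ESet → Set
  Chordless C = ∀ e → e ∉ C → OnV C (src e) → OnV C (tgt e) → Data.Empty.⊥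
    where import Data.Empty

  TwoFactor : ESet → Set
  TwoFactor F = ∀ v → deg F v ≡ 2

  TwoFactorOfTwoCircuits : ESet → ESet → Set
  TwoFactorOfTwoCircuits C₁ C₂ =
      IsCircuit C₁ × IsCircuit C₂
    × (∀ v → ¬ (OnV C₁ v × OnV C₂ v))
    × TwoFactor (C₁ ∪ C₂)

  IsCDC : (k : ℕ) → (Fin k → ESet) → Set
  IsCDC k 𝒮 = (∀ i → IsCycle (𝒮 i))
            × (∀ e → ∣ tabulate (λ i → lookup (𝒮 i) e) ∣ ≡ 2)

-- Write V = 𝔽₂².  The edges outside C₁ ∪ C₂ form a perfect matching M, and chordlessness makes every
-- matching edge join a vertex of C₁ to its partner on C₂.  Label C₂ by nonzero vectors s e ∈ V whose
-- boundary ∂s is nonzero at every vertex (a parity join W of C₂, with one edge d₀ labelled (1,1)).  A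
-- 0-chain of even weight on a connected subgraph is a boundary, so there is a colouring c : C₁ → V with
-- ∂c u = ∂s (partner u) ≠ 0, i.e. the two C₁-edges at u get distinct colours α ≠ β, and a chain q on C₂
-- whose boundary at partner u records whether 0 ∈ {α, β}.  For x ∈ V let D x consist of the C₁-edges of
-- colour x, the matching edges at whose C₁-end exactly one edge has colour x, and the C₂-edges e with
-- ω(x, s e) = q e, for ω the symplectic form on V.  Then each C₁-edge lies in exactly one D x and every
-- other edge in exactly two, and every D x is even: at a C₂-vertex this is an identity in V (ω-pair).
-- Together with C₁ the four cycles D x form the 5-CDC.

module Submission where

open import Defs
open import Algebra.Bundles using (CommutativeRing)
import Algebra.Properties.Semiring.Sum as SemiringSum
open import Data.Bool using (Bool; true; false; not; _∧_; _∨_; _xor_; if_then_else_)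
import Data.Bool.Properties as Bool
open import Data.Empty using (⊥-elim)
open import Data.Fin using (Fin; zero; suc) renaming (_≟_ to _≟ᶠ_)
open import Data.Fin.Patterns using (0F; 1F; 2F; 3F; 4F)
open import Data.Fin.Subset using (Subset; ∣_∣; _∉_; _∪_; ⊤)
open import Data.Fin.Subset.Properties using (nonempty?)
open import Data.Nat using (ℕ; zero; suc; _+_; _<_; z≤n; s≤s)
open import Data.Nat.Properties using (_<?_)
import Data.Nat.Properties as ℕ
open import Data.Product using (Σ; ∃; ∃₂; _×_; _,_; proj₁; proj₂; curry)
open import Data.Product.Properties using (≡-dec)
open import Data.Sum using (_⊎_; inj₁; inj₂)
open import Data.Vec using ([]; _∷_; lookup; tabulate; zipWith)
open import Data.Vec.Properties
  using (lookup-zipWith; lookup∘tabulate; tabulate∘lookup; lookup-replicate; []=⇒lookup; tabulate-cong)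
open import Function using (_∘_)
open import Relation.Binary.Definitions using (DecidableEquality)
open import Relation.Binary.PropositionalEquality
  using (_≡_; _≢_; refl; sym; trans; cong; cong₂; subst; subst₂; module ≡-Reasoning)
open import Relation.Nullary using (¬_; Dec; does; yes; no)
open import Relation.Nullary.Decidable
  using (dec-true; dec-false; toSum; map′; _×-dec_; _→-dec_; ¬?; from-yes)
open import Relation.Unary using (Decidable)

private
  variable
    k : ℕ

-- Chains over 𝔽₂ indexed by Fin k

module 𝔽₂ = SemiringSum (CommutativeRing.semiring Bool.xor-∧-commutativeRing)
module ℕΣ = SemiringSum ℕ.+-*-semiring

Chain : ℕ → Set
Chain k = Fin k → Bool

infixr 7 _∩_ _·_
infixr 5 _⊕_
infix 4 _⊆_

∅ : Chain k
∅ _ = false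

_⊕_ _∩_ : Chain k → Chain k → Chain k
(f ⊕ g) i = f i xor g i
(f ∩ g) i = f i ∧ g i

_·_ : Bool → Chain k → Chain k
(b · f) i = b ∧ f i

_⊆_ : Chain k → Chain k → Set
f ⊆ g = ∀ {i} → f i ≡ true → g i ≡ true

[_] : Fin k → Chain k
[ a ] i = does (a ≟ᶠ i)

_-_ : Chain k → Fin k → Chain k
(f - a) i = f i ∧ not ([ a ] i)

∑ : Chain k → Bool
∑ = 𝔽₂.sum

bit : Bool → ℕ
bit b = if b then 1 else 0

# : Chain k → ℕ
# f = ℕΣ.sum (bit ∘ f)

odd : ℕ → Bool
odd zero = false
odd (suc n) = not (odd n)

true≢false : true ≢ false
true≢false ()

∧≡true : ∀ {a b} → a ∧ b ≡ true → a ≡ true × b ≡ true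
∧≡true {true} {true} _ = refl , refl

∨≡true : ∀ {a b} → a ∨ b ≡ true → a ≡ true ⊎ b ≡ true
∨≡true {true} _ = inj₁ refl
∨≡true {false} h = inj₂ h

xor≡true : ∀ {a b} → a xor b ≡ true → a ≡ true ⊎ b ≡ true
xor≡true {true} _ = inj₁ refl
xor≡true {false} h = inj₂ h

[]-refl : ∀ (a : Fin k) → [ a ] a ≡ true
[]-refl a = dec-true (a ≟ᶠ a) refl

[]-≢ : ∀ {a i : Fin k} → a ≢ i → [ a ] i ≡ false
[]-≢ {a = a} {i} = dec-false (a ≟ᶠ i)

[]⇒≡ : ∀ {a i : Fin k} → [ a ] i ≡ true → a ≡ i
[]⇒≡ {a = a} {i} h with a ≟ᶠ i | h
... | yes a≡i | _ = a≡i

[]-sym : ∀ (a i : Fin k) → [ a ] i ≡ [ i ] a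
[]-sym a i with a ≟ᶠ i
... | yes refl = sym ([]-refl a)
... | no a≢i = sym ([]-≢ (a≢i ∘ sym))

∑-cong : ∀ {f g : Chain k} → (∀ i → f i ≡ g i) → ∑ f ≡ ∑ g
∑-cong = 𝔽₂.sum-cong-≗

∑-∅ : ∀ k → ∑ (∅ {k}) ≡ false
∑-∅ = 𝔽₂.sum-replicate-zero

∑-⊕ : ∀ (f g : Chain k) → ∑ (f ⊕ g) ≡ ∑ f xor ∑ g
∑-⊕ = 𝔽₂.∑-distrib-+

∑-· : ∀ b (f : Chain k) → ∑ (b · f) ≡ b ∧ ∑ f
∑-· b f = sym (𝔽₂.*-distribˡ-sum b f)

∑-∩-[] : ∀ (f : Chain k) a → ∑ (f ∩ [ a ]) ≡ f a
∑-∩-[] {suc k} f zero =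
  trans (cong₂ _xor_ (Bool.∧-identityʳ (f zero))
                     (trans (∑-cong (λ i → Bool.∧-zeroʳ (f (suc i)))) (∑-∅ k)))
        (Bool.xor-identityʳ (f zero))
∑-∩-[] {suc k} f (suc a) =
  trans (cong (_xor ∑ ((f ∘ suc) ∩ [ a ])) (Bool.∧-zeroʳ (f zero))) (∑-∩-[] (f ∘ suc) a)

∑-witness : ∀ (f : Chain k) → ∑ f ≡ true → ∃ λ i → f i ≡ true
∑-witness {suc k} f h with f zero in eq
... | true = zero , eq
... | false = let i , fi = ∑-witness (f ∘ suc) h in suc i , fi

#-cong : ∀ {f g : Chain k} → (∀ i → f i ≡ g i) → # f ≡ # g
#-cong f≗g = ℕΣ.sum-cong-≗ (cong bit ∘ f≗g)

odd-# : ∀ (f : Chain k) → odd (# f) ≡ ∑ f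
odd-# {zero} f = refl
odd-# {suc k} f with f zero
... | true = cong not (odd-# (f ∘ suc))
... | false = odd-# (f ∘ suc)

odd≡false⇒Even : ∀ n → odd n ≡ false → Even n
odd≡false⇒Even zero _ = 0 , refl
odd≡false⇒Even (suc (suc n)) h with odd≡false⇒Even n (trans (sym (Bool.not-involutive (odd n))) h)
... | j , n≡j+j = suc j , cong suc (trans (cong suc n≡j+j) (sym (ℕ.+-suc j j)))

lookup≡false⇒∉ : ∀ {p : Subset k} {i} → lookup p i ≡ false → i ∉ p
lookup≡false⇒∉ pi≡false i∈p = true≢false (trans (sym ([]=⇒lookup i∈p)) pi≡false)

∣∣≡# : ∀ (p : Subset k) → ∣ p ∣ ≡ # (lookup p)
∣∣≡# [] = refl
∣∣≡# (true ∷ p) = cong suc (∣∣≡# p)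
∣∣≡# (false ∷ p) = ∣∣≡# p

#-remove : ∀ (f : Chain k) {a} → f a ≡ true → # f ≡ suc (# (f - a))
#-remove {suc k} f {zero} fa =
  trans (cong (λ b → bit b + # (f ∘ suc)) fa)
        (cong suc (cong₂ (λ b n → bit b + n) (sym (Bool.∧-zeroʳ (f zero)))
                                             (#-cong (λ i → sym (Bool.∧-identityʳ (f (suc i)))))))
#-remove {suc k} f {suc a} fa =
  trans (cong (bit (f zero) +_) (#-remove (f ∘ suc) fa))
        (trans (ℕ.+-suc (bit (f zero)) _)
               (cong (λ b → suc (bit b + # ((f ∘ suc) - a))) (sym (Bool.∧-identityʳ (f zero)))))

#-witness : ∀ (f : Chain k) → 0 < # f → ∃ λ i → f i ≡ true
#-witness {suc k} f h with f zero in eq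
... | true = zero , eq
... | false = let i , fi = #-witness (f ∘ suc) h in suc i , fi

#-pos : ∀ (f : Chain k) {j} → # f ≡ suc j → ∃ λ a → f a ≡ true × # (f - a) ≡ j
#-pos f h =
  let a , fa = #-witness f (subst (0 <_) (sym h) (s≤s z≤n))
  in a , fa , ℕ.suc-injective (trans (sym (#-remove f fa)) h)

#≡0⇒∅ : ∀ (f : Chain k) → # f ≡ 0 → ∀ i → f i ≡ false
#≡0⇒∅ f h i with f i in eq
... | false = refl
... | true = ⊥-elim (ℕ.0≢1+n (trans (sym h) (#-remove f eq)))

f≗[a]⊕f-a : ∀ (f : Chain k) {a} → f a ≡ true → ∀ i → f i ≡ ([ a ] ⊕ (f - a)) i
f≗[a]⊕f-a f {a} fa i with [ a ] i in eq
... | true = let fi = subst (λ x → f x ≡ true) ([]⇒≡ eq) fa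
             in trans fi (cong (λ b → true xor (b ∧ false)) (sym fi))
... | false = sym (Bool.∧-identityʳ (f i))

#≡1⇒singleton : ∀ (f : Chain k) → # f ≡ 1 → ∃ λ a → ∀ i → f i ≡ [ a ] i
#≡1⇒singleton f h =
  let a , fa , #rest = #-pos f h
  in a , λ i → trans (f≗[a]⊕f-a f fa i)
                     (trans (cong ([ a ] i xor_) (#≡0⇒∅ (f - a) #rest i)) (Bool.xor-identityʳ ([ a ] i)))

#≡2⇒pair : ∀ (f : Chain k) → # f ≡ 2 → ∃₂ λ a b → a ≢ b × (∀ i → f i ≡ ([ a ] ⊕ [ b ]) i)
#≡2⇒pair f h with #-pos f h
... | a , fa , #rest with #≡1⇒singleton (f - a) #rest
... | b , rest≗[b] = a , b , a≢b , λ i → trans (f≗[a]⊕f-a f fa i) (cong ([ a ] i xor_) (rest≗[b] i))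
  where
  a≢b : a ≢ b
  a≢b refl = true≢false (trans (sym (trans (rest≗[b] a) ([]-refl a)))
                               (trans (cong (λ c → f a ∧ not c) ([]-refl a)) (Bool.∧-zeroʳ (f a))))

bit-split : ∀ a b → bit b ≡ bit (a ∧ b) + bit (not a ∧ b)
bit-split true b = sym (ℕ.+-identityʳ (bit b))
bit-split false b = refl

#-split : ∀ (h g : Chain k) → # g ≡ # (h ∩ g) + # ((not ∘ h) ∩ g)
#-split h g = trans (ℕΣ.sum-cong-≗ (λ i → bit-split (h i) (g i)))
                    (ℕΣ.∑-distrib-+ (bit ∘ (h ∩ g)) (bit ∘ ((not ∘ h) ∩ g)))

⊕-⊆ : ∀ {f g h : Chain k} → f ⊆ h → g ⊆ h → f ⊕ g ⊆ h
⊕-⊆ {f = f} f⊆h g⊆h {i} fg with xor≡true {f i} fg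
... | inj₁ fi = f⊆h fi
... | inj₂ gi = g⊆h gi

·-⊆ : ∀ {b} {f h : Chain k} → f ⊆ h → b · f ⊆ h
·-⊆ f⊆h bf = f⊆h (proj₂ (∧≡true bf))

⊆-false : ∀ {f g : Chain k} {i} → f ⊆ g → g i ≡ false → f i ≡ false
⊆-false {f = f} {i = i} f⊆g gi with f i in fi
... | false = refl
... | true = ⊥-elim (true≢false (trans (sym (f⊆g fi)) gi))

[]-⊆ : ∀ {a} {h : Chain k} → h a ≡ true → [ a ] ⊆ h
[]-⊆ {h = h} ha eq = subst (λ x → h x ≡ true) ([]⇒≡ eq) ha

∑-[] : ∀ (a : Fin k) → ∑ [ a ] ≡ true
∑-[] = ∑-∩-[] (λ _ → true)

xor-cancelˡ : ∀ a b → a xor (a xor b) ≡ b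
xor-cancelˡ a b = trans (sym (Bool.xor-assoc a a b)) (cong (_xor b) (Bool.xor-same a))

∑-restrict : ∀ {f h : Chain k} → f ⊆ h → ∀ g → ∑ (f ∩ g) ≡ ∑ (f ∩ (h ∩ g))
∑-restrict {f = f} {h} f⊆h g = ∑-cong absorb
  where
  absorb : ∀ i → f i ∧ g i ≡ f i ∧ (h i ∧ g i)
  absorb i with f i in fi
  ... | true = cong (_∧ g i) (sym (f⊆h fi))
  ... | false = refl

xor-telescope : ∀ a b c → (a xor b) xor (b xor c) ≡ a xor c
xor-telescope a b c =
  trans (Bool.xor-assoc a b (b xor c))
        (cong (a xor_) (trans (sym (Bool.xor-assoc b b c)) (cong (_xor c) (Bool.xor-same b))))

-- Boundaries, walks and fillings in a graph

module Boundary (G : Graph) where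
  open Graph G

  inc : Fin n → Chain m
  inc v e = [ src e ] v ∨ [ tgt e ] v

  ∂ : Chain m → Chain n
  ∂ f v = ∑ (f ∩ inc v)

  δ : Chain n → Chain m
  δ T e = T (src e) xor T (tgt e)

  inc≡⊕ : ∀ v e → inc v e ≡ ([ src e ] ⊕ [ tgt e ]) v
  inc≡⊕ v e with src e ≟ᶠ v | tgt e ≟ᶠ v
  ... | yes s≡v | yes t≡v = ⊥-elim (loopless e (trans s≡v (sym t≡v)))
  ... | yes _ | no _ = refl
  ... | no _ | _ = refl

  inc-src : ∀ e → inc (src e) e ≡ true
  inc-src e = cong (_∨ [ tgt e ] (src e)) ([]-refl (src e))

  inc-tgt : ∀ e → inc (tgt e) e ≡ true
  inc-tgt e = trans (cong ([ src e ] (tgt e) ∨_) ([]-refl (tgt e))) (Bool.∨-zeroʳ _)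

  deg≡# : ∀ S v → deg G S v ≡ # (lookup S ∩ inc v)
  deg≡# S v = trans (∣∣≡# (zipWith _∧_ S (incident G v))) (#-cong (λ e →
    trans (lookup-zipWith _∧_ e S (incident G v)) (cong (lookup S e ∧_) (lookup∘tabulate (inc v) e))))

  OnV⇒edge : ∀ {S v} → OnV G S v → ∃ λ e → lookup S e ≡ true × inc v e ≡ true
  OnV⇒edge {S} {v} h =
    let e , he = #-witness (lookup S ∩ inc v) (subst (0 <_) (deg≡# S v) h) in e , ∧≡true he

  edge⇒OnV : ∀ {S v e} → lookup S e ≡ true → inc v e ≡ true → OnV G S v
  edge⇒OnV {S} {v} Se ve =
    subst (0 <_) (sym (trans (deg≡# S v) (#-remove (lookup S ∩ inc v) (cong₂ _∧_ Se ve)))) (s≤s z≤n)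

  ∂-cong : ∀ {f g : Chain m} → (∀ e → f e ≡ g e) → ∀ v → ∂ f v ≡ ∂ g v
  ∂-cong f≗g v = ∑-cong (λ e → cong (_∧ inc v e) (f≗g e))

  ∂-⊕ : ∀ (f g : Chain m) v → ∂ (f ⊕ g) v ≡ ∂ f v xor ∂ g v
  ∂-⊕ f g v = trans (∑-cong (λ e → Bool.∧-distribʳ-xor (inc v e) (f e) (g e)))
                    (∑-⊕ (f ∩ inc v) (g ∩ inc v))

  ∂-· : ∀ b (f : Chain m) v → ∂ (b · f) v ≡ b ∧ ∂ f v
  ∂-· b f v = trans (∑-cong (λ e → Bool.∧-assoc b (f e) (inc v e))) (∑-· b (f ∩ inc v))

  ∂-[] : ∀ e v → ∂ [ e ] v ≡ inc v e
  ∂-[] e v = trans (∑-cong (λ i → Bool.∧-comm ([ e ] i) (inc v i))) (∑-∩-[] (inc v) e)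

  ∑∂≡false : ∀ f → ∑ (∂ f) ≡ false
  ∑∂≡false f = begin
    ∑ (λ v → ∑ (λ e → f e ∧ inc v e))
      ≡⟨ 𝔽₂.∑-comm (λ v e → f e ∧ inc v e) ⟩
    ∑ (λ e → ∑ (λ v → f e ∧ inc v e))
      ≡⟨ ∑-cong (λ e → trans (∑-· (f e) (λ v → inc v e)) (cong (f e ∧_) (ends e))) ⟩
    ∑ (λ e → f e ∧ false)
      ≡⟨ ∑-cong (λ e → Bool.∧-zeroʳ (f e)) ⟩
    ∑ (∅ {m})
      ≡⟨ ∑-∅ m ⟩
    false ∎
    where
    open ≡-Reasoning
    ends : ∀ e → ∑ (λ v → inc v e) ≡ false
    ends e = trans (∑-cong (λ v → inc≡⊕ v e))
                   (trans (∑-⊕ [ src e ] [ tgt e ]) (cong₂ _xor_ (∑-[] (src e)) (∑-[] (tgt e))))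

  ∂-support : ∀ {S f v} → f ⊆ lookup S → ∂ f v ≡ true → OnV G S v
  ∂-support {S} {f} {v} f⊆S h =
    let e , he = ∑-witness (f ∩ inc v) h ; fe , ve = ∧≡true he in edge⇒OnV {S} (f⊆S fe) ve

  ∂-outside : ∀ {S f v} → f ⊆ lookup S → ¬ OnV G S v → ∂ f v ≡ false
  ∂-outside {S} {f} {v} f⊆S v∉S with ∂ f v in eq
  ... | false = refl
  ... | true = ⊥-elim (v∉S (∂-support {S} f⊆S eq))

  odd-deg : ∀ S v → odd (deg G S v) ≡ ∂ (lookup S) v
  odd-deg S v = trans (cong odd (deg≡# S v)) (odd-# (lookup S ∩ inc v))

  cycle-tabulate : ∀ f → (∀ v → ∂ f v ≡ false) → IsCycle G (tabulate f)
  cycle-tabulate f even v = odd≡false⇒Even (deg G (tabulate f) v)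
    (trans (odd-deg (tabulate f) v) (trans (∂-cong (lookup∘tabulate f) v) (even v)))

  ∂-circuit : ∀ {C} → IsCircuit G C → ∀ v → ∂ (lookup C) v ≡ false
  ∂-circuit {C} (_ , regular , _) v with deg G C v in d≡
  ... | zero = trans (sym (odd-deg C v)) (cong odd d≡)
  ... | suc _ = trans (sym (odd-deg C v)) (cong odd (regular v (subst (0 <_) (sym d≡) (s≤s z≤n))))

  circuit-edge : ∀ {C} → IsCircuit G C → ∃ λ e → lookup C e ≡ true
  circuit-edge {C} (nonempty , _) with nonempty? C
  ... | yes (e , e∈C) = e , []=⇒lookup e∈C
  ... | no empty = ⊥-elim (nonempty empty)

  opposite : Fin m → Fin n → Fin n
  opposite e v = if [ src e ] v then tgt e else src e

  incident-ends : ∀ {v e} → inc v e ≡ true →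
                  (src e ≡ v × tgt e ≡ opposite e v) ⊎ (tgt e ≡ v × src e ≡ opposite e v)
  incident-ends {v} {e} h with src e ≟ᶠ v | tgt e ≟ᶠ v | h
  ... | yes s≡v | _ | _ = inj₁ (s≡v , refl)
  ... | no _ | yes t≡v | _ = inj₂ (t≡v , refl)

  δ-at : ∀ T {v e} → inc v e ≡ true → δ T e ≡ T v xor T (opposite e v)
  δ-at T {v} {e} h with incident-ends h
  ... | inj₁ (s≡v , t≡o) = cong₂ (λ x y → T x xor T y) s≡v t≡o
  ... | inj₂ (t≡v , s≡o) =
    trans (Bool.xor-comm (T (src e)) (T (tgt e))) (cong₂ (λ x y → T x xor T y) t≡v s≡o)

  inc-opposite : ∀ {v e} → inc v e ≡ true → inc (opposite e v) e ≡ true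
  inc-opposite {v} {e} h with incident-ends h
  ... | inj₁ (_ , t≡o) = subst (λ x → inc x e ≡ true) t≡o (inc-tgt e)
  ... | inj₂ (_ , s≡o) = subst (λ x → inc x e ≡ true) s≡o (inc-src e)

  opposite-opposite : ∀ {v e} → inc v e ≡ true → opposite e (opposite e v) ≡ v
  opposite-opposite {v} {e} h with incident-ends h | incident-ends (inc-opposite h)
  ... | inj₁ (s≡v , t≡o) | inj₁ (s≡o , _) = ⊥-elim (loopless e (trans s≡o (sym t≡o)))
  ... | inj₁ (s≡v , _) | inj₂ (_ , s≡oo) = trans (sym s≡oo) s≡v
  ... | inj₂ (t≡v , _) | inj₁ (_ , t≡oo) = trans (sym t≡oo) t≡v
  ... | inj₂ (t≡v , s≡o) | inj₂ (t≡o , _) = ⊥-elim (loopless e (trans s≡o (sym t≡o)))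

  chord-free : ∀ {C v e} → Chordless G C → lookup C e ≡ false → inc v e ≡ true →
               OnV G C v → ¬ OnV G C (opposite e v)
  chord-free {C} {v} {e} chordless e∉C h v∈C o∈C with incident-ends h
  ... | inj₁ (s≡v , t≡o) =
    chordless e (lookup≡false⇒∉ e∉C) (subst (OnV G C) (sym s≡v) v∈C) (subst (OnV G C) (sym t≡o) o∈C)
  ... | inj₂ (t≡v , s≡o) =
    chordless e (lookup≡false⇒∉ e∉C) (subst (OnV G C) (sym s≡o) o∈C) (subst (OnV G C) (sym t≡v) v∈C)

  record Filling (S : ESet G) (T : Chain n) : Set where
    field
      chain : Chain m
      chain⊆ : chain ⊆ lookup S
      ∂chain : ∀ v → ∂ chain v ≡ T v

  module _ {S : ESet G} where

    walk : ∀ {u v} → Reach G S u v → Chain m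
    walk here = ∅
    walk (step e _ _ _ p) = [ e ] ⊕ walk p
    walk (stepᵣ e _ _ _ p) = [ e ] ⊕ walk p

    walk⊆ : ∀ {u v} (p : Reach G S u v) → walk p ⊆ lookup S
    walk⊆ here ()
    walk⊆ (step e e∈S _ _ p) =
      ⊕-⊆ {f = [ e ]} {g = walk p} ([]-⊆ {h = lookup S} ([]=⇒lookup e∈S)) (walk⊆ p)
    walk⊆ (stepᵣ e e∈S _ _ p) =
      ⊕-⊆ {f = [ e ]} {g = walk p} ([]-⊆ {h = lookup S} ([]=⇒lookup e∈S)) (walk⊆ p)

    ∂-walk : ∀ {u v} (p : Reach G S u v) w → ∂ (walk p) w ≡ [ u ] w xor [ v ] w
    ∂-walk {u} here w = trans (∑-∅ m) (sym (Bool.xor-same ([ u ] w)))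
    ∂-walk {v = v} (step e _ refl refl p) w = begin
      ∂ ([ e ] ⊕ walk p) w
        ≡⟨ ∂-⊕ [ e ] (walk p) w ⟩
      ∂ [ e ] w xor ∂ (walk p) w
        ≡⟨ cong₂ _xor_ (trans (∂-[] e w) (inc≡⊕ w e)) (∂-walk p w) ⟩
      ([ src e ] w xor [ tgt e ] w) xor ([ tgt e ] w xor [ v ] w)
        ≡⟨ xor-telescope ([ src e ] w) ([ tgt e ] w) ([ v ] w) ⟩
      [ src e ] w xor [ v ] w ∎
      where open ≡-Reasoning
    ∂-walk {v = v} (stepᵣ e _ refl refl p) w = begin
      ∂ ([ e ] ⊕ walk p) w
        ≡⟨ ∂-⊕ [ e ] (walk p) w ⟩
      ∂ [ e ] w xor ∂ (walk p) w
        ≡⟨ cong₂ _xor_ (trans (∂-[] e w) (inc≡⊕ w e)) (∂-walk p w) ⟩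
      ([ src e ] w xor [ tgt e ] w) xor ([ src e ] w xor [ v ] w)
        ≡⟨ cong (_xor ([ src e ] w xor [ v ] w)) (Bool.xor-comm ([ src e ] w) ([ tgt e ] w)) ⟩
      ([ tgt e ] w xor [ src e ] w) xor ([ src e ] w xor [ v ] w)
        ≡⟨ xor-telescope ([ tgt e ] w) ([ src e ] w) ([ v ] w) ⟩
      [ tgt e ] w xor [ v ] w ∎
      where open ≡-Reasoning

    towards : ∀ r v b → (b ≡ true → Reach G S r v) → Chain m
    towards r v true p = walk (p refl)
    towards r v false _ = ∅

    towards⊆ : ∀ r v b p → towards r v b p ⊆ lookup S
    towards⊆ r v true p = walk⊆ (p refl)
    towards⊆ r v false p ()

    ∂-towards : ∀ r v b p w → ∂ (towards r v b p) w ≡ b ∧ ([ r ] w xor [ v ] w)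
    ∂-towards r v true p w = ∂-walk (p refl) w
    ∂-towards r v false p w = ∑-∅ m

    fill-rooted : ∀ r (T : Chain n) → (∀ v → T v ≡ true → Reach G S r v) →
                  Filling S (λ w → T w xor (∑ T ∧ [ r ] w))
    fill-rooted r T reach = record { chain = Z ; chain⊆ = Z⊆S ; ∂chain = ∂Z }
      where
      t : Fin n → Chain m
      t v = towards r v (T v) (reach v)
      Z : Chain m
      Z e = ∑ (λ v → t v e)
      Z⊆S : Z ⊆ lookup S
      Z⊆S h = let v , tv = ∑-witness _ h in towards⊆ r v (T v) (reach v) tv
      ∂Z : ∀ w → ∂ Z w ≡ T w xor (∑ T ∧ [ r ] w)
      ∂Z w = begin
        ∑ (λ e → ∑ (λ v → t v e) ∧ inc w e)
          ≡⟨ ∑-cong (λ e → 𝔽₂.*-distribʳ-sum (inc w e) (λ v → t v e)) ⟩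
        ∑ (λ e → ∑ (λ v → t v e ∧ inc w e))
          ≡⟨ 𝔽₂.∑-comm (λ e v → t v e ∧ inc w e) ⟩
        ∑ (λ v → ∂ (t v) w)
          ≡⟨ ∑-cong (λ v → ∂-towards r v (T v) (reach v) w) ⟩
        ∑ (λ v → T v ∧ ([ r ] w xor [ v ] w))
          ≡⟨ ∑-cong (λ v → Bool.∧-distribˡ-xor (T v) _ _) ⟩
        ∑ ((λ v → T v ∧ [ r ] w) ⊕ (λ v → T v ∧ [ v ] w))
          ≡⟨ ∑-⊕ (λ v → T v ∧ [ r ] w) (λ v → T v ∧ [ v ] w) ⟩
        ∑ (λ v → T v ∧ [ r ] w) xor ∑ (λ v → T v ∧ [ v ] w)
          ≡⟨ cong₂ _xor_ (sym (𝔽₂.*-distribʳ-sum ([ r ] w) T)) point ⟩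
        (∑ T ∧ [ r ] w) xor T w
          ≡⟨ Bool.xor-comm _ (T w) ⟩
        T w xor (∑ T ∧ [ r ] w) ∎
        where
        open ≡-Reasoning
        point : ∑ (λ v → T v ∧ [ v ] w) ≡ T w
        point = trans (∑-cong (λ v → cong (T v ∧_) ([]-sym v w))) (∑-∩-[] T w)

    fill : ∀ r (T : Chain n) → (∀ v → T v ≡ true → Reach G S r v) → ∑ T ≡ false → Filling S T
    fill r T reach ∑T≡false = record
      { chain = chain
      ; chain⊆ = chain⊆
      ; ∂chain = λ w → trans (∂chain w) (trans (cong (λ b → T w xor (b ∧ [ r ] w)) ∑T≡false)
                                               (Bool.xor-identityʳ (T w)))
      }
      where open Filling (fill-rooted r T reach)

-- The plane V = 𝔽₂²

V : Set
V = Bool × Bool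

𝟘 : V
𝟘 = false , false

_+ⱽ_ : V → V → V
α +ⱽ β = proj₁ α xor proj₁ β , proj₂ α xor proj₂ β

nonzero : V → Bool
nonzero s = proj₁ s ∨ proj₂ s

_≟ⱽ_ : DecidableEquality V
_≟ⱽ_ = ≡-dec Bool._≟_ Bool._≟_

_==_ : V → V → Bool
α == x = does (α ≟ⱽ x)

ω : V → V → Bool
ω x s = (proj₁ x ∧ proj₂ s) xor (proj₂ x ∧ proj₁ s)

spread : (V → Bool) → Bool → Fin 5 → Bool
spread p b 0F = p (false , false)
spread p b 1F = p (false , true)
spread p b 2F = p (true , false)
spread p b 3F = p (true , true)
spread p b 4F = b

spread-cong : ∀ {p q : V → Bool} {b c} → (∀ x → p x ≡ q x) → b ≡ c →
              ∀ i → spread p b i ≡ spread q c i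
spread-cong p≗q _ 0F = p≗q _
spread-cong p≗q _ 1F = p≗q _
spread-cong p≗q _ 2F = p≗q _
spread-cong p≗q _ 3F = p≗q _
spread-cong p≗q b≡c 4F = b≡c

∀-Bool? : ∀ {P : Bool → Set} → Decidable P → Dec (∀ b → P b)
∀-Bool? P? = map′ (λ (t , f) → λ { true → t ; false → f }) (λ h → h true , h false)
                  (P? true ×-dec P? false)

∀-V? : ∀ {P : V → Set} → Decidable P → Dec (∀ x → P x)
∀-V? P? = map′ (λ h x → h (proj₁ x) (proj₂ x)) (λ h x₁ x₂ → h (x₁ , x₂))
               (∀-Bool? λ x₁ → ∀-Bool? λ x₂ → P? (x₁ , x₂))

nonzero⇒≢ : ∀ α β → nonzero (α +ⱽ β) ≡ true → α ≢ β
nonzero⇒≢ (a , b) _ h refl = true≢false (trans (sym h) (cong₂ _∨_ (Bool.xor-same a) (Bool.xor-same b)))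

-- For t = α + β ≠ 0, ω(·, t) is the indicator of V ∖ {0, t}, and {α, β} is either {0, t} or V ∖ {0, t}.
ω-pair : ∀ α β → α ≢ β →
         ∀ x → ω x (α +ⱽ β) xor ((α == 𝟘) xor (β == 𝟘)) ≡ (α == x) xor (β == x)
ω-pair = from-yes (∀-V? λ α → ∀-V? λ β → ¬? (α ≟ⱽ β) →-dec ∀-V? λ x →
  (ω x (α +ⱽ β) xor ((α == 𝟘) xor (β == 𝟘))) Bool.≟ ((α == x) xor (β == x)))

point-cover : ∀ α → ∣ tabulate (spread (α ==_) true) ∣ ≡ 2
point-cover = from-yes (∀-V? λ α → ∣ tabulate (spread (α ==_) true) ∣ ℕ.≟ 2)

pair-cover : ∀ α β → α ≢ β → ∣ tabulate (spread (λ x → (α == x) xor (β == x)) false) ∣ ≡ 2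
pair-cover = from-yes (∀-V? λ α → ∀-V? λ β → ¬? (α ≟ⱽ β) →-dec
  ∣ tabulate (spread (λ x → (α == x) xor (β == x)) false) ∣ ℕ.≟ 2)

line-cover : ∀ s q → nonzero s ≡ true → ∣ tabulate (spread (λ x → true xor (ω x s xor q)) false) ∣ ≡ 2
line-cover = from-yes (∀-V? λ s → ∀-Bool? λ q → (nonzero s Bool.≟ true) →-dec
  ∣ tabulate (spread (λ x → true xor (ω x s xor q)) false) ∣ ℕ.≟ 2)

-- A cubic graph with a 2-factor of two chordless circuits

module TwoCircuits (G : Graph) (cubic : Cubic G) (C₁ C₂ : ESet G)
                   (two-factor : TwoFactorOfTwoCircuits G C₁ C₂)
                   (chordless₁ : Chordless G C₁) (chordless₂ : Chordless G C₂) where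
  open Graph G
  open Boundary G

  circuit₁ : IsCircuit G C₁
  circuit₁ = proj₁ two-factor

  circuit₂ : IsCircuit G C₂
  circuit₂ = proj₁ (proj₂ two-factor)

  vertex-disjoint : ∀ v → ¬ (OnV G C₁ v × OnV G C₂ v)
  vertex-disjoint = proj₁ (proj₂ (proj₂ two-factor))

  spanning : TwoFactor G (C₁ ∪ C₂)
  spanning = proj₂ (proj₂ (proj₂ two-factor))

  c₁ c₂ matching : Chain m
  c₁ = lookup C₁
  c₂ = lookup C₂
  matching e = not (c₁ e ∨ c₂ e)

  on₁⊎on₂ : ∀ v → OnV G C₁ v ⊎ OnV G C₂ v
  on₁⊎on₂ v with OnV⇒edge {C₁ ∪ C₂} (subst (0 <_) (sym (spanning v)) (s≤s z≤n))
  ... | e , e∈F , ve with ∨≡true (trans (sym (lookup-zipWith _∨_ e C₁ C₂)) e∈F)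
  ... | inj₁ e∈C₁ = inj₁ (edge⇒OnV {C₁} e∈C₁ ve)
  ... | inj₂ e∈C₂ = inj₂ (edge⇒OnV {C₂} e∈C₂ ve)

  c₁⇒¬c₂ : ∀ {e} → c₁ e ≡ true → c₂ e ≡ false
  c₁⇒¬c₂ {e} e∈C₁ with c₂ e in e∈C₂
  ... | false = refl
  ... | true = ⊥-elim (vertex-disjoint (src e)
                         (edge⇒OnV {C₁} e∈C₁ (inc-src e) , edge⇒OnV {C₂} e∈C₂ (inc-src e)))

  c₂⇒¬c₁ : ∀ {e} → c₂ e ≡ true → c₁ e ≡ false
  c₂⇒¬c₁ {e} e∈C₂ with c₁ e in e∈C₁
  ... | false = refl
  ... | true = ⊥-elim (true≢false (trans (sym e∈C₂) (c₁⇒¬c₂ e∈C₁)))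

  matching⇒¬c₁ : ∀ {e} → matching e ≡ true → c₁ e ≡ false
  matching⇒¬c₁ {e} h with c₁ e | h
  ... | false | _ = refl

  matching⇒¬c₂ : ∀ {e} → matching e ≡ true → c₂ e ≡ false
  matching⇒¬c₂ {e} h with c₁ e | c₂ e | h
  ... | false | false | _ = refl

  edge-class : ∀ e → c₁ e ≡ true ⊎ c₂ e ≡ true ⊎ matching e ≡ true
  edge-class e with c₁ e | c₂ e
  ... | true | _ = inj₁ refl
  ... | false | true = inj₂ (inj₁ refl)
  ... | false | false = inj₂ (inj₂ refl)

  #matching : ∀ v → # (matching ∩ inc v) ≡ 1
  #matching v = ℕ.+-cancelˡ-≡ 2 (# (matching ∩ inc v)) 1 (begin
    2 + # (matching ∩ inc v)               ≡⟨ cong (_+ # (matching ∩ inc v)) #F ⟨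
    # (F ∩ inc v) + # (matching ∩ inc v)   ≡⟨ #-split F (inc v) ⟨
    # (inc v)                              ≡⟨ #inc ⟩
    3                                      ∎)
    where
    open ≡-Reasoning
    F : Chain m
    F e = c₁ e ∨ c₂ e
    #F : # (F ∩ inc v) ≡ 2
    #F = trans (#-cong (λ e → cong (_∧ inc v e) (sym (lookup-zipWith _∨_ e C₁ C₂))))
               (trans (sym (deg≡# (C₁ ∪ C₂) v)) (spanning v))
    #inc : # (inc v) ≡ 3
    #inc = trans (#-cong (λ e → cong (_∧ inc v e) (sym (lookup-replicate e true))))
                 (trans (sym (deg≡# ⊤ v)) (cubic v))

  -- Only the specifications of the chosen edges and fillings below matter; keeping the choices opaque
  -- stops unification from unfolding the searches that produce them.
  opaque
    matchingEdge : Fin n → Fin m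
    matchingEdge v = proj₁ (#≡1⇒singleton (matching ∩ inc v) (#matching v))

    matching∩inc : ∀ v e → (matching ∩ inc v) e ≡ [ matchingEdge v ] e
    matching∩inc v = proj₂ (#≡1⇒singleton (matching ∩ inc v) (#matching v))

  matchingEdge-at : ∀ v → matching (matchingEdge v) ≡ true × inc v (matchingEdge v) ≡ true
  matchingEdge-at v = ∧≡true (trans (matching∩inc v (matchingEdge v)) ([]-refl (matchingEdge v)))

  matchingEdge-unique : ∀ {v e} → matching e ≡ true → inc v e ≡ true → matchingEdge v ≡ e
  matchingEdge-unique {v} {e} me ve = []⇒≡ (trans (sym (matching∩inc v e)) (cong₂ _∧_ me ve))

  partner : Fin n → Fin n
  partner v = opposite (matchingEdge v) v

  partner-involutive : ∀ v → partner (partner v) ≡ v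
  partner-involutive v = begin
    opposite (matchingEdge (partner v)) (partner v)
      ≡⟨ cong (λ e → opposite e (partner v)) same-edge ⟩
    opposite (matchingEdge v) (partner v)
      ≡⟨ opposite-opposite (proj₂ (matchingEdge-at v)) ⟩
    v ∎
    where
    open ≡-Reasoning
    same-edge : matchingEdge (partner v) ≡ matchingEdge v
    same-edge = matchingEdge-unique (proj₁ (matchingEdge-at v)) (inc-opposite (proj₂ (matchingEdge-at v)))

  ∂-matching : ∀ T v → ∂ (matching ∩ δ T) v ≡ T v xor T (partner v)
  ∂-matching T v = begin
    ∑ ((matching ∩ δ T) ∩ inc v)  ≡⟨ ∑-cong rearrange ⟩
    ∑ (δ T ∩ (matching ∩ inc v))  ≡⟨ ∑-cong (λ e → cong (δ T e ∧_) (matching∩inc v e)) ⟩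
    ∑ (δ T ∩ [ matchingEdge v ])  ≡⟨ ∑-∩-[] (δ T) (matchingEdge v) ⟩
    δ T (matchingEdge v)          ≡⟨ δ-at T (proj₂ (matchingEdge-at v)) ⟩
    T v xor T (partner v)         ∎
    where
    open ≡-Reasoning
    rearrange : ∀ e → (matching e ∧ δ T e) ∧ inc v e ≡ δ T e ∧ (matching e ∧ inc v e)
    rearrange e = trans (cong (_∧ inc v e) (Bool.∧-comm (matching e) (δ T e)))
                        (Bool.∧-assoc (δ T e) (matching e) (inc v e))

  partner-on₂ : ∀ {v} → OnV G C₁ v → OnV G C₂ (partner v)
  partner-on₂ {v} v∈C₁ with on₁⊎on₂ (partner v)
  ... | inj₁ p∈C₁ = ⊥-elim (chord-free chordless₁ (matching⇒¬c₁ (proj₁ (matchingEdge-at v)))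
                                        (proj₂ (matchingEdge-at v)) v∈C₁ p∈C₁)
  ... | inj₂ p∈C₂ = p∈C₂

  partner-on₁ : ∀ {v} → OnV G C₂ v → OnV G C₁ (partner v)
  partner-on₁ {v} v∈C₂ with on₁⊎on₂ (partner v)
  ... | inj₁ p∈C₁ = p∈C₁
  ... | inj₂ p∈C₂ = ⊥-elim (chord-free chordless₂ (matching⇒¬c₂ (proj₁ (matchingEdge-at v)))
                                        (proj₂ (matchingEdge-at v)) v∈C₂ p∈C₂)

  partner-off₁ : ∀ {v} → OnV G C₁ v → ¬ OnV G C₁ (partner v)
  partner-off₁ {v} v∈C₁ p∈C₁ = vertex-disjoint (partner v) (p∈C₁ , partner-on₂ v∈C₁)

  matching-at-C₁ : ∀ {e} → matching e ≡ true → ∃ λ u → OnV G C₁ u × matchingEdge u ≡ e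
  matching-at-C₁ {e} e∈M with on₁⊎on₂ (src e) | on₁⊎on₂ (tgt e)
  ... | inj₁ s∈C₁ | _ = src e , s∈C₁ , matchingEdge-unique e∈M (inc-src e)
  ... | inj₂ _ | inj₁ t∈C₁ = tgt e , t∈C₁ , matchingEdge-unique e∈M (inc-tgt e)
  ... | inj₂ s∈C₂ | inj₂ t∈C₂ =
    ⊥-elim (chordless₂ e (lookup≡false⇒∉ (matching⇒¬c₂ e∈M)) s∈C₂ t∈C₂)

  ∑-transfer : ∀ T → ∑ (λ v → T (partner v)) ≡ ∑ T
  ∑-transfer T = begin
    ∑ (λ v → T (partner v))
      ≡⟨ ∑-cong (λ v → trans (sym (xor-cancelˡ (T v) _)) (cong (T v xor_) (sym (∂-matching T v)))) ⟩
    ∑ (T ⊕ ∂ (matching ∩ δ T))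
      ≡⟨ ∑-⊕ T (∂ (matching ∩ δ T)) ⟩
    ∑ T xor ∑ (∂ (matching ∩ δ T))
      ≡⟨ cong (∑ T xor_) (∑∂≡false (matching ∩ δ T)) ⟩
    ∑ T xor false
      ≡⟨ Bool.xor-identityʳ (∑ T) ⟩
    ∑ T ∎
    where open ≡-Reasoning

  fill-transfer : ∀ {C C'} → IsCircuit G C' → (∀ {v} → OnV G C v → OnV G C' (partner v)) →
                  ∀ A → A ⊆ lookup C → Filling C' (λ v → ∂ A (partner v))
  fill-transfer {C} {C'} circuit' swaps A A⊆C =
    fill r (λ v → ∂ A (partner v)) reach (trans (∑-transfer (∂ A)) (∑∂≡false A))
    where
    r : Fin n
    r = src (proj₁ (circuit-edge circuit'))
    r∈C' : OnV G C' r
    r∈C' = edge⇒OnV {C'} (proj₂ (circuit-edge circuit')) (inc-src _)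
    reach : ∀ v → ∂ A (partner v) ≡ true → Reach G C' r v
    reach v h = proj₂ (proj₂ circuit') r v r∈C'
                  (subst (OnV G C') (partner-involutive v) (swaps (∂-support {C} A⊆C h)))

  opaque
    d₀ : Fin m
    d₀ = proj₁ (circuit-edge circuit₂)

    d₀∈C₂ : c₂ d₀ ≡ true
    d₀∈C₂ = proj₂ (circuit-edge circuit₂)

  v₀ : Fin n
  v₀ = src d₀

  on₂ : Chain n
  on₂ v = does (0 <? deg G C₂ v)

  on₂⇒OnV : ∀ {v} → on₂ v ≡ true → OnV G C₂ v
  on₂⇒OnV {v} h with 0 <? deg G C₂ v
  ... | yes v∈C₂ = v∈C₂
  ... | no v∉C₂ = ⊥-elim (true≢false (trans (sym h) (dec-false (0 <? deg G C₂ v) v∉C₂)))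

  opaque
    W-filling : Filling C₂ (λ v → on₂ v xor (∑ on₂ ∧ [ v₀ ] v))
    W-filling = fill-rooted v₀ on₂ (λ v h → proj₂ (proj₂ circuit₂) v₀ v v₀∈C₂ (on₂⇒OnV h))
      where
      v₀∈C₂ : OnV G C₂ v₀
      v₀∈C₂ = edge⇒OnV {C₂} d₀∈C₂ (inc-src d₀)

  open Filling W-filling renaming (chain to W; chain⊆ to W⊆c₂; ∂chain to ∂W)

  -- S₁ = W ∪ {d₀} and S₂ = (C₂ ∖ W) ∪ {d₀}, written as sums so that ∂ distributes over them.
  S₁ S₂ : Chain m
  S₁ = W ⊕ not (W d₀) · [ d₀ ]
  S₂ = c₂ ⊕ W ⊕ W d₀ · [ d₀ ]

  W⊕d₀⊆c₂ : ∀ b → W ⊕ b · [ d₀ ] ⊆ c₂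
  W⊕d₀⊆c₂ b = ⊕-⊆ {f = W} W⊆c₂ (·-⊆ {f = [ d₀ ]} ([]-⊆ {h = c₂} d₀∈C₂))

  S₁⊆c₂ : S₁ ⊆ c₂
  S₁⊆c₂ = W⊕d₀⊆c₂ (not (W d₀))

  S₂⊆c₂ : S₂ ⊆ c₂
  S₂⊆c₂ = ⊕-⊆ {f = c₂} (λ h → h) (W⊕d₀⊆c₂ (W d₀))

  s-nonzero : ∀ {e} → c₂ e ≡ true → nonzero (S₁ e , S₂ e) ≡ true
  s-nonzero {e} e∈C₂ = check (W e) (W d₀) (c₂ e) ([ d₀ ] e) e∈C₂ (λ p → cong W (sym ([]⇒≡ p)))
    where
    check : ∀ w w₀ c p → c ≡ true → (p ≡ true → w ≡ w₀) →
            nonzero (w xor (not w₀ ∧ p) , c xor (w xor (w₀ ∧ p))) ≡ true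
    check = from-yes (∀-Bool? λ w → ∀-Bool? λ w₀ → ∀-Bool? λ c → ∀-Bool? λ p →
      (c Bool.≟ true) →-dec ((p Bool.≟ true) →-dec (w Bool.≟ w₀)) →-dec
      (nonzero (w xor (not w₀ ∧ p) , c xor (w xor (w₀ ∧ p))) Bool.≟ true))

  ∂s-nonzero : ∀ {v} → OnV G C₂ v → nonzero (∂ S₁ v , ∂ S₂ v) ≡ true
  ∂s-nonzero {v} v∈C₂ =
    subst₂ (λ a b → nonzero (a , b) ≡ true) (sym ∂S₁) (sym ∂S₂)
           (check (∂ c₂ v) (∂ W v) (inc v d₀) (W d₀) (∂-circuit circuit₂ v) W-or-d₀)
    where
    check : ∀ c p q w → c ≡ false → p ∨ q ≡ true →
            nonzero (p xor (not w ∧ q) , c xor (p xor (w ∧ q))) ≡ true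
    check = from-yes (∀-Bool? λ c → ∀-Bool? λ p → ∀-Bool? λ q → ∀-Bool? λ w →
      (c Bool.≟ false) →-dec ((p ∨ q) Bool.≟ true) →-dec
      (nonzero (p xor (not w ∧ q) , c xor (p xor (w ∧ q))) Bool.≟ true))
    ∂S₁ : ∂ S₁ v ≡ ∂ W v xor (not (W d₀) ∧ inc v d₀)
    ∂S₁ = trans (∂-⊕ W (not (W d₀) · [ d₀ ]) v)
                (cong (∂ W v xor_) (trans (∂-· (not (W d₀)) [ d₀ ] v)
                                          (cong (not (W d₀) ∧_) (∂-[] d₀ v))))
    ∂S₂ : ∂ S₂ v ≡ ∂ c₂ v xor (∂ W v xor (W d₀ ∧ inc v d₀))
    ∂S₂ = trans (∂-⊕ c₂ (W ⊕ W d₀ · [ d₀ ]) v) (cong (∂ c₂ v xor_)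
                (trans (∂-⊕ W (W d₀ · [ d₀ ]) v)
                       (cong (∂ W v xor_) (trans (∂-· (W d₀) [ d₀ ] v) (cong (W d₀ ∧_) (∂-[] d₀ v))))))
    W-or-d₀ : ∂ W v ∨ inc v d₀ ≡ true
    W-or-d₀ with toSum (v₀ ≟ᶠ v)
    ... | inj₁ refl = trans (cong (∂ W v₀ ∨_) (inc-src d₀)) (Bool.∨-zeroʳ (∂ W v₀))
    ... | inj₂ v₀≢v = cong (_∨ inc v d₀) (begin
      ∂ W v
        ≡⟨ ∂W v ⟩
      on₂ v xor (∑ on₂ ∧ [ v₀ ] v)
        ≡⟨ cong₂ (λ a b → a xor (∑ on₂ ∧ b)) (dec-true (0 <? deg G C₂ v) v∈C₂) ([]-≢ v₀≢v) ⟩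
      true xor (∑ on₂ ∧ false)
        ≡⟨ cong (true xor_) (Bool.∧-zeroʳ (∑ on₂)) ⟩
      true ∎)
      where open ≡-Reasoning

  opaque
    Z₁-filling : Filling C₁ (λ v → ∂ S₁ (partner v))
    Z₁-filling = fill-transfer {C₂} circuit₁ partner-on₁ S₁ S₁⊆c₂

    Z₂-filling : Filling C₁ (λ v → ∂ S₂ (partner v))
    Z₂-filling = fill-transfer {C₂} circuit₁ partner-on₁ S₂ S₂⊆c₂

  open Filling Z₁-filling renaming (chain to Z₁; chain⊆ to Z₁⊆c₁; ∂chain to ∂Z₁)
  open Filling Z₂-filling renaming (chain to Z₂; chain⊆ to Z₂⊆c₁; ∂chain to ∂Z₂)

  colour : Fin m → V
  colour e = Z₁ e , Z₂ e

  K : V → Chain m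
  K x e = c₁ e ∧ (colour e == x)

  K⊆c₁ : ∀ x → K x ⊆ c₁
  K⊆c₁ x h = proj₁ (∧≡true h)

  opaque
    Q-filling : Filling C₂ (λ v → ∂ (K 𝟘) (partner v))
    Q-filling = fill-transfer {C₁} circuit₂ partner-on₂ (K 𝟘) (K⊆c₁ 𝟘)

  open Filling Q-filling renaming (chain to Q; chain⊆ to Q⊆c₂; ∂chain to ∂Q)

  L : V → Chain m
  L x = c₂ ⊕ (proj₁ x · S₂ ⊕ proj₂ x · S₁) ⊕ Q

  L⊆c₂ : ∀ x → L x ⊆ c₂
  L⊆c₂ x = ⊕-⊆ {f = c₂} (λ h → h) (⊕-⊆ {f = proj₁ x · S₂ ⊕ proj₂ x · S₁} ωs⊆c₂ Q⊆c₂)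
    where
    ωs⊆c₂ : proj₁ x · S₂ ⊕ proj₂ x · S₁ ⊆ c₂
    ωs⊆c₂ = ⊕-⊆ {f = proj₁ x · S₂} (·-⊆ {f = S₂} S₂⊆c₂) (·-⊆ {f = S₁} S₁⊆c₂)

  D : V → Chain m
  D x = K x ⊕ matching ∩ δ (∂ (K x)) ⊕ L x

  ∂L : ∀ x v → ∂ (L x) v ≡ ω x (∂ S₁ v , ∂ S₂ v) xor ∂ Q v
  ∂L x v = begin
    ∂ (L x) v
      ≡⟨ ∂-⊕ c₂ (ωs ⊕ Q) v ⟩
    ∂ c₂ v xor ∂ (ωs ⊕ Q) v
      ≡⟨ cong₂ _xor_ (∂-circuit circuit₂ v) (∂-⊕ ωs Q v) ⟩
    ∂ ωs v xor ∂ Q v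
      ≡⟨ cong (_xor ∂ Q v) (trans (∂-⊕ (proj₁ x · S₂) (proj₂ x · S₁) v)
                                  (cong₂ _xor_ (∂-· (proj₁ x) S₂ v) (∂-· (proj₂ x) S₁ v))) ⟩
    ω x (∂ S₁ v , ∂ S₂ v) xor ∂ Q v ∎
    where
    open ≡-Reasoning
    ωs : Chain m
    ωs = proj₁ x · S₂ ⊕ proj₂ x · S₁

  ∂D : ∀ x v → ∂ (D x) v ≡ ∂ (K x) (partner v) xor ∂ (L x) v
  ∂D x v = begin
    ∂ (D x) v
      ≡⟨ ∂-⊕ (K x) (matching ∩ δ (∂ (K x)) ⊕ L x) v ⟩
    κ xor ∂ (matching ∩ δ (∂ (K x)) ⊕ L x) v
      ≡⟨ cong (κ xor_) (∂-⊕ (matching ∩ δ (∂ (K x))) (L x) v) ⟩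
    κ xor (∂ (matching ∩ δ (∂ (K x))) v xor ℓ)
      ≡⟨ cong (λ t → κ xor (t xor ℓ)) (∂-matching (∂ (K x)) v) ⟩
    κ xor ((κ xor κ′) xor ℓ)
      ≡⟨ Bool.xor-assoc κ (κ xor κ′) ℓ ⟨
    (κ xor (κ xor κ′)) xor ℓ
      ≡⟨ cong (_xor ℓ) (xor-cancelˡ κ κ′) ⟩
    κ′ xor ℓ ∎
    where
    open ≡-Reasoning
    κ κ′ ℓ : Bool
    κ = ∂ (K x) v
    κ′ = ∂ (K x) (partner v)
    ℓ = ∂ (L x) v

  D-on-C₁ : ∀ {e} → c₁ e ≡ true → ∀ x → D x e ≡ colour e == x
  D-on-C₁ {e} e∈C₁ x =
    trans (cong₂ (λ c l → (c ∧ (colour e == x)) xor ((not (c ∨ c₂ e) ∧ δ (∂ (K x)) e) xor l))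
                 e∈C₁ (⊆-false {f = L x} {i = e} (L⊆c₂ x) (c₁⇒¬c₂ e∈C₁)))
          (Bool.xor-identityʳ (colour e == x))

  D-on-C₂ : ∀ {e} → c₂ e ≡ true → ∀ x → D x e ≡ true xor (ω x (S₁ e , S₂ e) xor Q e)
  D-on-C₂ {e} e∈C₂ x =
    cong₂ (λ c₁e c₂e → (c₁e ∧ (colour e == x)) xor ((not (c₁e ∨ c₂e) ∧ δ (∂ (K x)) e)
                                                     xor (c₂e xor (ω x (S₁ e , S₂ e) xor Q e))))
          (c₂⇒¬c₁ e∈C₂) e∈C₂

  D-on-matching : ∀ {e} → matching e ≡ true → ∀ x → D x e ≡ δ (∂ (K x)) e
  D-on-matching {e} e∈M x =
    trans (cong₂ (λ c l → (c ∧ (colour e == x)) xor ((matching e ∧ δ (∂ (K x)) e) xor l))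
                 (matching⇒¬c₁ e∈M) (⊆-false {f = L x} {i = e} (L⊆c₂ x) (matching⇒¬c₂ e∈M)))
          (trans (cong (λ t → (t ∧ δ (∂ (K x)) e) xor false) e∈M) (Bool.xor-identityʳ (δ (∂ (K x)) e)))

  module Star (u : Fin n) (u∈C₁ : OnV G C₁ u) where

    opaque
      star : ∃₂ λ a b → a ≢ b × (∀ e → (c₁ ∩ inc u) e ≡ ([ a ] ⊕ [ b ]) e)
      star = #≡2⇒pair (c₁ ∩ inc u) (trans (sym (deg≡# C₁ u)) (proj₁ (proj₂ circuit₁) u u∈C₁))

    a b : Fin m
    a = proj₁ star
    b = proj₁ (proj₂ star)

    a≢b : a ≢ b
    a≢b = proj₁ (proj₂ (proj₂ star))

    c₁∩inc : ∀ e → (c₁ ∩ inc u) e ≡ ([ a ] ⊕ [ b ]) e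
    c₁∩inc = proj₂ (proj₂ (proj₂ star))

    a∈C₁ : c₁ a ≡ true
    a∈C₁ = proj₁ (∧≡true (trans (c₁∩inc a) (cong₂ _xor_ ([]-refl a) ([]-≢ (a≢b ∘ sym)))))

    b∈C₁ : c₁ b ≡ true
    b∈C₁ = proj₁ (∧≡true (trans (c₁∩inc b) (cong₂ _xor_ ([]-≢ a≢b) ([]-refl b))))

    ∂-star : ∀ f → f ⊆ c₁ → ∂ f u ≡ f a xor f b
    ∂-star f f⊆c₁ = begin
      ∑ (f ∩ inc u)
        ≡⟨ ∑-restrict f⊆c₁ (inc u) ⟩
      ∑ (f ∩ (c₁ ∩ inc u))
        ≡⟨ ∑-cong (λ e → cong (f e ∧_) (c₁∩inc e)) ⟩
      ∑ (f ∩ ([ a ] ⊕ [ b ]))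
        ≡⟨ ∑-cong (λ e → Bool.∧-distribˡ-xor (f e) ([ a ] e) ([ b ] e)) ⟩
      ∑ (f ∩ [ a ] ⊕ f ∩ [ b ])
        ≡⟨ ∑-⊕ (f ∩ [ a ]) (f ∩ [ b ]) ⟩
      ∑ (f ∩ [ a ]) xor ∑ (f ∩ [ b ])
        ≡⟨ cong₂ _xor_ (∑-∩-[] f a) (∑-∩-[] f b) ⟩
      f a xor f b ∎
      where open ≡-Reasoning

    ∂K : ∀ x → ∂ (K x) u ≡ (colour a == x) xor (colour b == x)
    ∂K x = trans (∂-star (K x) (K⊆c₁ x))
                 (cong₂ _xor_ (cong (_∧ (colour a == x)) a∈C₁) (cong (_∧ (colour b == x)) b∈C₁))

    ∂s-at-partner : (∂ S₁ (partner u) , ∂ S₂ (partner u)) ≡ colour a +ⱽ colour b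
    ∂s-at-partner = cong₂ _,_ (trans (sym (∂Z₁ u)) (∂-star Z₁ Z₁⊆c₁))
                              (trans (sym (∂Z₂ u)) (∂-star Z₂ Z₂⊆c₁))

    colours-differ : colour a ≢ colour b
    colours-differ = nonzero⇒≢ (colour a) (colour b)
      (subst (λ t → nonzero t ≡ true) ∂s-at-partner (∂s-nonzero (partner-on₂ u∈C₁)))

    ∂L-at-partner : ∀ x → ∂ (L x) (partner u) ≡ ∂ (K x) u
    ∂L-at-partner x = begin
      ∂ (L x) (partner u)
        ≡⟨ ∂L x (partner u) ⟩
      ω x (∂ S₁ (partner u) , ∂ S₂ (partner u)) xor ∂ Q (partner u)
        ≡⟨ cong₂ (λ t q → ω x t xor q) ∂s-at-partner ∂Q-at-partner ⟩
      ω x (colour a +ⱽ colour b) xor ((colour a == 𝟘) xor (colour b == 𝟘))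
        ≡⟨ ω-pair (colour a) (colour b) colours-differ x ⟩
      (colour a == x) xor (colour b == x)
        ≡⟨ ∂K x ⟨
      ∂ (K x) u ∎
      where
      open ≡-Reasoning
      ∂Q-at-partner : ∂ Q (partner u) ≡ (colour a == 𝟘) xor (colour b == 𝟘)
      ∂Q-at-partner = trans (∂Q (partner u)) (trans (cong (∂ (K 𝟘)) (partner-involutive u)) (∂K 𝟘))

    D-at-matchingEdge : ∀ x → D x (matchingEdge u) ≡ (colour a == x) xor (colour b == x)
    D-at-matchingEdge x = begin
      D x (matchingEdge u)
        ≡⟨ D-on-matching (proj₁ (matchingEdge-at u)) x ⟩
      δ (∂ (K x)) (matchingEdge u)
        ≡⟨ δ-at (∂ (K x)) (proj₂ (matchingEdge-at u)) ⟩
      ∂ (K x) u xor ∂ (K x) (partner u)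
        ≡⟨ cong (∂ (K x) u xor_) (∂-outside {C₁} (K⊆c₁ x) (partner-off₁ u∈C₁)) ⟩
      ∂ (K x) u xor false
        ≡⟨ Bool.xor-identityʳ (∂ (K x) u) ⟩
      ∂ (K x) u
        ≡⟨ ∂K x ⟩
      (colour a == x) xor (colour b == x) ∎
      where open ≡-Reasoning

  D-even : ∀ x v → ∂ (D x) v ≡ false
  D-even x v with on₁⊎on₂ v
  ... | inj₁ v∈C₁ =
    trans (∂D x v) (cong₂ _xor_ (∂-outside {C₁} (K⊆c₁ x) (partner-off₁ v∈C₁))
                                (∂-outside {C₂} (L⊆c₂ x) (curry (vertex-disjoint v) v∈C₁)))
  ... | inj₂ v∈C₂ = begin
    ∂ (D x) v
      ≡⟨ ∂D x v ⟩
    ∂ (K x) (partner v) xor ∂ (L x) v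
      ≡⟨ cong (λ w → ∂ (K x) (partner v) xor ∂ (L x) w) (partner-involutive v) ⟨
    ∂ (K x) (partner v) xor ∂ (L x) (partner (partner v))
      ≡⟨ cong (∂ (K x) (partner v) xor_) (Star.∂L-at-partner (partner v) (partner-on₁ v∈C₂) x) ⟩
    ∂ (K x) (partner v) xor ∂ (K x) (partner v)
      ≡⟨ Bool.xor-same (∂ (K x) (partner v)) ⟩
    false ∎
    where open ≡-Reasoning

  multiplicity : ∀ e → ∣ tabulate (spread (λ x → D x e) (c₁ e)) ∣ ≡ 2
  multiplicity e with edge-class e
  ... | inj₁ e∈C₁ =
    trans (cong ∣_∣ (tabulate-cong (spread-cong (D-on-C₁ e∈C₁) e∈C₁))) (point-cover (colour e))
  ... | inj₂ (inj₁ e∈C₂) =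
    trans (cong ∣_∣ (tabulate-cong (spread-cong (D-on-C₂ e∈C₂) (c₂⇒¬c₁ e∈C₂))))
          (line-cover (S₁ e , S₂ e) (Q e) (s-nonzero e∈C₂))
  ... | inj₂ (inj₂ e∈M) with matching-at-C₁ e∈M
  ... | u , u∈C₁ , refl =
    trans (cong ∣_∣ (tabulate-cong (spread-cong D-at-matchingEdge (matching⇒¬c₁ e∈M))))
          (pair-cover (colour a) (colour b) colours-differ)
    where open Star u u∈C₁

  family : Fin 5 → ESet G
  family i = tabulate (λ e → spread (λ x → D x e) (c₁ e) i)

  family-cycles : ∀ i → IsCycle G (family i)
  family-cycles i = cycle-tabulate (λ e → spread (λ x → D x e) (c₁ e) i) (even i)
    where
    even : ∀ i v → ∂ (λ e → spread (λ x → D x e) (c₁ e) i) v ≡ false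
    even 0F = D-even (false , false)
    even 1F = D-even (false , true)
    even 2F = D-even (true , false)
    even 3F = D-even (true , true)
    even 4F = ∂-circuit circuit₁

  family-multiplicity : ∀ e → ∣ tabulate (λ i → lookup (family i) e) ∣ ≡ 2
  family-multiplicity e =
    trans (cong ∣_∣ (tabulate-cong (λ i → lookup∘tabulate (λ e → spread (λ x → D x e) (c₁ e) i) e)))
          (multiplicity e)

corollary4p4 : (G : Graph) → Cubic G → TwoEdgeConnected G
    → (C₁ C₂ : ESet G) → TwoFactorOfTwoCircuits G C₁ C₂
    → Chordless G C₁ → Chordless G C₂
    → Σ (Fin 5 → ESet G) (λ 𝒮 → IsCDC G 5 𝒮 × Σ (Fin 5) (λ i → 𝒮 i ≡ C₁))
-- The construction does not use 2-edge-connectivity.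
corollary4p4 G cubic _ C₁ C₂ two-factor chordless₁ chordless₂ =
  family , (family-cycles , family-multiplicity) , 4F , tabulate∘lookup C₁
  where open TwoCircuits G cubic C₁ C₂ two-factor chordless₁ chordless₂
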